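{- Let $\Gamma=(V,E)$ be a finite connected $k$-regular graph with $k\ge1$, with $V=\{v_1,\ldots,v_m\}$ where $m=|V|$ and adjacency matrix $A$ (rows and columns indexed by $v_1,\ldots,v_m$). Let $\tau=\{W_1,\ldots,W_n\}$ be an equitable partition of $\Gamma$ with quotient matrix $M_\tau=(c_{ij})_{1\le i,j\le n}$. Let $1\le i,j\le n$ with $i\ne j$, put $r_{ij}=c_{ij}/(k+c_{ij}-c_{jj})$, and let $(d_1,\ldots,d_n)$ be any solution of the linear system $$\sum_{s=1}^n c_{ls}x_s+(c_{ij}-c_{jj})x_l=(c_{lj}-c_{ij})+\delta_{lj}(c_{ij}-c_{jj}),\qquad 1\le l\le n.$$ Then the vector $[h_1,\ldots,h_m]^\top$ defined by $$h_t=-r_{ij}-\sum_{1\le l\le n,\ v_t\in W_l}(d_l-\delta_{lj}),\qquad 1\le t\le m,$$ satisfies $(A+(c_{ij}-c_{jj})I_m)[h_1,\ldots,h_m]^\top=0$. In particular, either $(h_1,\ldots,h_m)=(0,\ldots,0)$ or $c_{jj}-c_{ij}$ is an eigenvalue of $\Gamma$ with $[h_1,\ldots,h_m]^\top$ as a corresponding eigenvector.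
   Context: Graphs are finite, simple and undirected. A partition $\{W_1,\ldots,W_n\}$ of the vertex set is an equitable partition with quotient matrix $(c_{ij})$ if for all $i,j$ every vertex of $W_i$ has exactly $c_{ij}$ neighbours in $W_j$. $\delta$ is the Kronecker delta. -}

module Defs where

open import Data.Nat as ℕ using (ℕ; zero; suc)
open import Data.Integer using (+_)
open import Data.Rational as ℚ using (ℚ; _/_)
open import Data.Fin using (Fin; _≟_)
open import Data.Bool using (Bool; true; false; if_then_else_)
open import Data.Product using (∃; _×_)
open import Relation.Nullary using (¬_)
open import Relation.Nullary.Decidable using (⌊_⌋)
open import Relation.Binary.PropositionalEquality using (_≡_)

sumℕ : ∀ {n} → (Fin n → ℕ) → ℕ
sumℕ {zero}  f = 0
sumℕ {suc n} f = f Data.Fin.zero ℕ.+ sumℕ (λ x → f (Data.Fin.suc x))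

sumℚ : ∀ {n} → (Fin n → ℚ) → ℚ
sumℚ {zero}  f = ℚ.0ℚ
sumℚ {suc n} f = f Data.Fin.zero ℚ.+ sumℚ (λ x → f (Data.Fin.suc x))

ι : ℕ → ℚ
ι n = (+ n) / 1

δ : ∀ {n} → Fin n → Fin n → ℚ
δ a b = if ⌊ a ≟ b ⌋ then ℚ.1ℚ else ℚ.0ℚ

record Graph (m : ℕ) : Set where
  field
    adj   : Fin m → Fin m → Bool
    sym   : ∀ u v → adj u v ≡ adj v u
    irrefl : ∀ v → adj v v ≡ false

open Graph public

deg : ∀ {m} → Graph m → Fin m → ℕ
deg G v = sumℕ (λ u → if adj G v u then 1 else 0)

Regular : ∀ {m} → Graph m → ℕ → Set
Regular G k = ∀ v → deg G v ≡ k

data Walk {m} (G : Graph m) : Fin m → Fin m → Set where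
  here : ∀ {v} → Walk G v v
  step : ∀ {u v w} → adj G u v ≡ true → Walk G v w → Walk G u w

Connected : ∀ {m} → Graph m → Set
Connected G = ∀ u v → Walk G u v

-- a partition {W_1..W_n} of V, given by the block map part (v ∈ W_(part v));
-- all blocks nonempty
IsPartition : ∀ {m n} → (Fin m → Fin n) → Set
IsPartition {m} part = ∀ l → ∃ λ (v : Fin m) → part v ≡ l

nbrsIn : ∀ {m n} → Graph m → (Fin m → Fin n) → Fin m → Fin n → ℕ
nbrsIn G part v j =
  sumℕ (λ u → if adj G v u then (if ⌊ part u ≟ j ⌋ then 1 else 0) else 0)

IsEquitable : ∀ {m n} → Graph m → (Fin m → Fin n) → (Fin n → Fin n → ℕ) → Set
IsEquitable G part c = IsPartition part × (∀ v j → nbrsIn G part v j ≡ c (part v) j)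

adjMat : ∀ {m} → Graph m → Fin m → Fin m → ℚ
adjMat G t u = if adj G t u then ℚ.1ℚ else ℚ.0ℚ

mulVec : ∀ {m} → (Fin m → Fin m → ℚ) → (Fin m → ℚ) → Fin m → ℚ
mulVec A x t = sumℚ (λ u → A t u ℚ.* x u)

IsZeroVec : ∀ {m} → (Fin m → ℚ) → Set
IsZeroVec x = ∀ t → x t ≡ ℚ.0ℚ

IsEigenvector : ∀ {m} → Graph m → ℚ → (Fin m → ℚ) → Set
IsEigenvector G λ' x = ¬ IsZeroVec x × (∀ t → mulVec (adjMat G) x t ≡ λ' ℚ.* x t)

IsEigenvalue : ∀ {m} → Graph m → ℚ → Set
IsEigenvalue G λ' = ∃ λ x → IsEigenvector G λ' x

-- quotient a / b of naturals as a rational; 0 if b = 0 (never happens below)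
divℕ : ℕ → ℕ → ℚ
divℕ a zero    = ℚ.0ℚ
divℕ a (suc b) = (+ a) / suc b

-- r_ij = c_ij / (k + c_ij - c_jj)   (c_jj ≤ k always, so ∸ is exact)
rij : ∀ {n} → ℕ → (Fin n → Fin n → ℕ) → Fin n → Fin n → ℚ
rij k c i j = divℕ (c i j) (k ℕ.+ c i j ℕ.∸ c j j)

SolvesSystem : ∀ {n} → (Fin n → Fin n → ℕ) → Fin n → Fin n → (Fin n → ℚ) → Set
SolvesSystem c i j d =
  ∀ l → sumℚ (λ s → ι (c l s) ℚ.* d s) ℚ.+ (ι (c i j) ℚ.- ι (c j j)) ℚ.* d l
        ≡ (ι (c l j) ℚ.- ι (c i j)) ℚ.+ δ l j ℚ.* (ι (c i j) ℚ.- ι (c j j))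

hvec : ∀ {m n} → ℕ → (Fin m → Fin n) → (Fin n → Fin n → ℕ) → Fin n → Fin n
       → (Fin n → ℚ) → Fin m → ℚ
hvec k part c i j d t =
  ℚ.- rij k c i j ℚ.-
    sumℚ (λ l → if ⌊ part t ≟ l ⌋ then d l ℚ.- δ l j else ℚ.0ℚ)

idMat : ∀ {m} → Fin m → Fin m → ℚ
idMat t u = δ t u

shiftMat : ∀ {m} → (Fin m → Fin m → ℚ) → ℚ → Fin m → Fin m → ℚ
shiftMat A a t u = A t u ℚ.+ a ℚ.* idMat t u

-- The vector h is constant on the blocks of τ: h = f ∘ part with f_l = −r_ij − (d_l − δ_lj).
-- For a block-constant vector, equitability turns A(f ∘ part) into (M_τ f) ∘ part, so it
-- suffices that (M_τ + (c_ij − c_jj) I) f = 0. The rows of M_τ sum to k, so the constant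
-- part −r_ij contributes −r_ij (k + c_ij − c_jj) = −c_ij, and the linear system makes the
-- d-part contribute exactly c_ij.

module Submission where

open import Defs
open import Data.Nat using (ℕ; _≥_)
open import Data.Fin using (Fin)
open import Data.Rational using (ℚ; _+_; _-_; _*_; 0ℚ)
open import Data.Product using (_×_)
open import Data.Sum using (_⊎_)
open import Relation.Binary.PropositionalEquality using (_≡_; _≢_)

open import Data.Nat as ℕ using (zero; suc)
import Data.Nat.Properties as ℕ
import Data.Integer as ℤ
import Data.Integer.Tactic.RingSolver as ℤ
open import Data.Rational using (1ℚ; -_; _/_; toℚᵘ)
open import Data.Rational.Properties
  using (+-*-commutativeRing; toℚᵘ-injective; toℚᵘ-fromℚᵘ; toℚᵘ-homo-+; toℚᵘ-homo-*;
         +-identityˡ; +-identityʳ; *-identityˡ; *-identityʳ; *-zeroˡ; *-zeroʳ; *-comm;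
         *-distribˡ-+; *-distribʳ-+; *-assoc)
  renaming (_≟_ to _≟ℚ_)
import Data.Rational.Unnormalised as ℚᵘ
import Data.Rational.Unnormalised.Properties as ℚᵘ
open import Data.Fin as Fin using (_≟_)
open import Data.Fin.Properties using (all?)
open import Data.Bool using (true; false; if_then_else_)
open import Data.Product using (_,_)
open import Data.Sum using (inj₁; inj₂)
open import Data.Maybe using (Maybe; just; nothing)
open import Function using (_∘_)
open import Relation.Nullary using (yes; no)
open import Relation.Nullary.Decidable using (⌊_⌋)
open import Relation.Binary.PropositionalEquality
  using (refl; trans; cong; cong₂; module ≡-Reasoning)
  renaming (sym to ≡-sym)
open import Data.Empty using (⊥-elim)
open import Tactic.RingSolver.Core.AlmostCommutativeRing
  using (AlmostCommutativeRing; fromCommutativeRing)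
open import Tactic.RingSolver using (solve-∀)

ℚ-ring : AlmostCommutativeRing _ _
ℚ-ring = fromCommutativeRing +-*-commutativeRing is-zero
  where
  is-zero : ∀ x → Maybe (0ℚ ≡ x)
  is-zero x with 0ℚ ≟ℚ x
  ... | yes p = just p
  ... | no _  = nothing

-- ι goes through the normalising _/_, so identities about it are checked in ℚᵘ.
ι-+ : ∀ x y → ι (x ℕ.+ y) ≡ ι x + ι y
ι-+ x y = toℚᵘ-injective (begin
  toℚᵘ (ι (x ℕ.+ y))
    ≈⟨ toℚᵘ-fromℚᵘ (ℚᵘ.mkℚᵘ (ℤ.+ (x ℕ.+ y)) 0) ⟩
  ℚᵘ.mkℚᵘ (ℤ.+ (x ℕ.+ y)) 0
    ≈⟨ ℚᵘ.*≡* (ℤ-identity (ℤ.+ x) (ℤ.+ y)) ⟩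
  ℚᵘ.mkℚᵘ (ℤ.+ x) 0 ℚᵘ.+ ℚᵘ.mkℚᵘ (ℤ.+ y) 0
    ≈⟨ ℚᵘ.+-cong (toℚᵘ-fromℚᵘ (ℚᵘ.mkℚᵘ (ℤ.+ x) 0)) (toℚᵘ-fromℚᵘ (ℚᵘ.mkℚᵘ (ℤ.+ y) 0)) ⟨
  toℚᵘ (ι x) ℚᵘ.+ toℚᵘ (ι y)
    ≈⟨ toℚᵘ-homo-+ (ι x) (ι y) ⟨
  toℚᵘ (ι x + ι y) ∎)
  where
  open ℚᵘ.≃-Reasoning
  ℤ-identity : ∀ a b → (a ℤ.+ b) ℤ.* ℤ.1ℤ ≡ (a ℤ.* ℤ.1ℤ ℤ.+ b ℤ.* ℤ.1ℤ) ℤ.* ℤ.1ℤ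
  ℤ-identity = ℤ.solve-∀

ι-∸ : ∀ x y → y ℕ.≤ x → ι (x ℕ.∸ y) ≡ ι x - ι y
ι-∸ x y y≤x = begin
  ι (x ℕ.∸ y)                ≡⟨ add-sub (ι (x ℕ.∸ y)) (ι y) ⟩
  (ι (x ℕ.∸ y) + ι y) - ι y  ≡⟨ cong (_- ι y) (ι-+ (x ℕ.∸ y) y) ⟨
  ι (x ℕ.∸ y ℕ.+ y) - ι y    ≡⟨ cong (λ z → ι z - ι y) (ℕ.m∸n+n≡m y≤x) ⟩
  ι x - ι y                  ∎
  where
  open ≡-Reasoning
  add-sub : ∀ a b → a ≡ (a + b) - b
  add-sub = solve-∀ ℚ-ring

divℕ-*-cancel : ∀ x N → x ℕ.≤ N → divℕ x N * ι N ≡ ι x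
divℕ-*-cancel x zero ℕ.z≤n = refl
divℕ-*-cancel x (suc b) _ = toℚᵘ-injective (begin
  toℚᵘ ((ℤ.+ x / suc b) * ι (suc b))
    ≈⟨ toℚᵘ-homo-* (ℤ.+ x / suc b) (ι (suc b)) ⟩
  toℚᵘ (ℤ.+ x / suc b) ℚᵘ.* toℚᵘ (ι (suc b))
    ≈⟨ ℚᵘ.*-cong (toℚᵘ-fromℚᵘ (ℚᵘ.mkℚᵘ (ℤ.+ x) b)) (toℚᵘ-fromℚᵘ (ℚᵘ.mkℚᵘ (ℤ.+ suc b) 0)) ⟩
  ℚᵘ.mkℚᵘ (ℤ.+ x) b ℚᵘ.* ℚᵘ.mkℚᵘ (ℤ.+ suc b) 0
    ≈⟨ ℚᵘ.*≡* (ℤ-identity (ℤ.+ x) (ℤ.+ suc b)) ⟩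
  ℚᵘ.mkℚᵘ (ℤ.+ x) 0
    ≈⟨ toℚᵘ-fromℚᵘ (ℚᵘ.mkℚᵘ (ℤ.+ x) 0) ⟨
  toℚᵘ (ι x) ∎)
  where
  open ℚᵘ.≃-Reasoning
  ℤ-identity : ∀ a b → (a ℤ.* b) ℤ.* ℤ.1ℤ ≡ a ℤ.* (b ℤ.* ℤ.1ℤ)
  ℤ-identity = ℤ.solve-∀

sumℚ-cong : ∀ {n} {f g : Fin n → ℚ} → (∀ x → f x ≡ g x) → sumℚ f ≡ sumℚ g
sumℚ-cong {zero}  f≗g = refl
sumℚ-cong {suc n} f≗g = cong₂ _+_ (f≗g Fin.zero) (sumℚ-cong (f≗g ∘ Fin.suc))

sumℚ-zero : ∀ n → sumℚ {n} (λ _ → 0ℚ) ≡ 0ℚ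
sumℚ-zero zero    = refl
sumℚ-zero (suc n) = cong (0ℚ +_) (sumℚ-zero n)

sumℚ-+ : ∀ {n} (f g : Fin n → ℚ) → sumℚ (λ x → f x + g x) ≡ sumℚ f + sumℚ g
sumℚ-+ {zero}  f g = refl
sumℚ-+ {suc n} f g =
  trans (cong ((f Fin.zero + g Fin.zero) +_) (sumℚ-+ (f ∘ Fin.suc) (g ∘ Fin.suc)))
        (interchange (f Fin.zero) (g Fin.zero) _ _)
  where
  interchange : ∀ a b c d → (a + b) + (c + d) ≡ (a + c) + (b + d)
  interchange = solve-∀ ℚ-ring

sumℚ-*ˡ : ∀ {n} a (f : Fin n → ℚ) → sumℚ (λ x → a * f x) ≡ a * sumℚ f
sumℚ-*ˡ {zero}  a f = ≡-sym (*-zeroʳ a)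
sumℚ-*ˡ {suc n} a f =
  trans (cong (a * f Fin.zero +_) (sumℚ-*ˡ a (f ∘ Fin.suc)))
        (≡-sym (*-distribˡ-+ a (f Fin.zero) _))

sumℚ-swap : ∀ {n m} (f : Fin n → Fin m → ℚ) →
  sumℚ (λ x → sumℚ (λ y → f x y)) ≡ sumℚ (λ y → sumℚ (λ x → f x y))
sumℚ-swap {zero}  {m} f = ≡-sym (sumℚ-zero m)
sumℚ-swap {suc n}     f =
  trans (cong (sumℚ (f Fin.zero) +_) (sumℚ-swap (f ∘ Fin.suc)))
        (≡-sym (sumℚ-+ (f Fin.zero) (λ y → sumℚ (λ x → f (Fin.suc x) y))))

δ-sym : ∀ {n} (a b : Fin n) → δ a b ≡ δ b a
δ-sym a b with a ≟ b | b ≟ a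
... | yes _   | yes _   = refl
... | no _    | no _    = refl
... | yes a≡b | no b≢a  = ⊥-elim (b≢a (≡-sym a≡b))
... | no a≢b  | yes b≡a = ⊥-elim (a≢b (≡-sym b≡a))

δ-suc : ∀ {n} (a b : Fin n) → δ (Fin.suc a) (Fin.suc b) ≡ δ a b
δ-suc a b with a ≟ b
... | yes _ = refl
... | no _  = refl

sumℚ-δˡ : ∀ {n} (p : Fin n) (f : Fin n → ℚ) → sumℚ (λ l → δ p l * f l) ≡ f p
sumℚ-δˡ {suc n} Fin.zero f = begin
  1ℚ * f Fin.zero + sumℚ (λ x → 0ℚ * f (Fin.suc x))
    ≡⟨ cong₂ _+_ (*-identityˡ (f Fin.zero))
                 (trans (sumℚ-cong (λ x → *-zeroˡ (f (Fin.suc x)))) (sumℚ-zero n)) ⟩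
  f Fin.zero + 0ℚ
    ≡⟨ +-identityʳ _ ⟩
  f Fin.zero ∎
  where open ≡-Reasoning
sumℚ-δˡ {suc n} (Fin.suc p) f = begin
  0ℚ * f Fin.zero + sumℚ (λ x → δ (Fin.suc p) (Fin.suc x) * f (Fin.suc x))
    ≡⟨ cong₂ _+_ (*-zeroˡ (f Fin.zero))
                 (sumℚ-cong (λ x → cong (_* f (Fin.suc x)) (δ-suc p x))) ⟩
  0ℚ + sumℚ (λ x → δ p x * f (Fin.suc x))
    ≡⟨ +-identityˡ _ ⟩
  sumℚ (λ x → δ p x * f (Fin.suc x))
    ≡⟨ sumℚ-δˡ p (f ∘ Fin.suc) ⟩
  f (Fin.suc p) ∎
  where open ≡-Reasoning

sumℚ-δʳ : ∀ {n} (p : Fin n) (f : Fin n → ℚ) → sumℚ (λ l → f l * δ l p) ≡ f p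
sumℚ-δʳ p f =
  trans (sumℚ-cong (λ l → trans (*-comm (f l) (δ l p)) (cong (_* f l) (δ-sym l p))))
        (sumℚ-δˡ p f)

sumℚ-select : ∀ {n} (p : Fin n) (f : Fin n → ℚ) →
  sumℚ (λ l → if ⌊ p ≟ l ⌋ then f l else 0ℚ) ≡ f p
sumℚ-select p f = trans (sumℚ-cong (λ l → select ⌊ p ≟ l ⌋ (f l))) (sumℚ-δˡ p f)
  where
  select : ∀ b x → (if b then x else 0ℚ) ≡ (if b then 1ℚ else 0ℚ) * x
  select true  x = ≡-sym (*-identityˡ x)
  select false x = ≡-sym (*-zeroˡ x)

ι-sumℕ : ∀ {n} (f : Fin n → ℕ) → ι (sumℕ f) ≡ sumℚ (ι ∘ f)
ι-sumℕ {zero}  f = refl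
ι-sumℕ {suc n} f = trans (ι-+ (f Fin.zero) _) (cong (ι (f Fin.zero) +_) (ι-sumℕ (f ∘ Fin.suc)))

sumℕ-mono-≤ : ∀ {n} {f g : Fin n → ℕ} → (∀ x → f x ℕ.≤ g x) → sumℕ f ℕ.≤ sumℕ g
sumℕ-mono-≤ {zero}  f≤g = ℕ.z≤n
sumℕ-mono-≤ {suc n} f≤g = ℕ.+-mono-≤ (f≤g Fin.zero) (sumℕ-mono-≤ (f≤g ∘ Fin.suc))

mulVec-shiftMat : ∀ {m} (A : Fin m → Fin m → ℚ) a x t →
  mulVec (shiftMat A a) x t ≡ mulVec A x t + a * x t
mulVec-shiftMat A a x t = begin
  sumℚ (λ u → (A t u + a * δ t u) * x u)
    ≡⟨ sumℚ-cong (λ u → *-distribʳ-+ (x u) (A t u) (a * δ t u)) ⟩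
  sumℚ (λ u → A t u * x u + a * δ t u * x u)
    ≡⟨ sumℚ-+ (λ u → A t u * x u) (λ u → a * δ t u * x u) ⟩
  mulVec A x t + sumℚ (λ u → a * δ t u * x u)
    ≡⟨ cong (mulVec A x t +_) (sumℚ-cong (λ u → *-assoc a (δ t u) (x u))) ⟩
  mulVec A x t + sumℚ (λ u → a * (δ t u * x u))
    ≡⟨ cong (mulVec A x t +_)
            (trans (sumℚ-*ˡ a (λ u → δ t u * x u)) (cong (a *_) (sumℚ-δˡ t x))) ⟩
  mulVec A x t + a * x t ∎
  where open ≡-Reasoning

shiftMat-kernel⇒eigen : ∀ {m} (A : Fin m → Fin m → ℚ) a λ' x → λ' + a ≡ 0ℚ →
  IsZeroVec (mulVec (shiftMat A a) x) → ∀ t → mulVec A x t ≡ λ' * x t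
shiftMat-kernel⇒eigen A a λ' x λ'+a≡0 Ax+ax≡0 t = begin
  mulVec A x t                                   ≡⟨ rearrange (mulVec A x t) (x t) a λ' ⟩
  (mulVec A x t + a * x t) + (λ' - (λ' + a)) * x t
    ≡⟨ cong₂ (λ u v → u + (λ' - v) * x t)
             (trans (≡-sym (mulVec-shiftMat A a x t)) (Ax+ax≡0 t)) λ'+a≡0 ⟩
  0ℚ + (λ' - 0ℚ) * x t                           ≡⟨ cleanup λ' (x t) ⟩
  λ' * x t                                       ∎
  where
  open ≡-Reasoning
  rearrange : ∀ y z a λ' → y ≡ (y + a * z) + (λ' - (λ' + a)) * z
  rearrange = solve-∀ ℚ-ring
  cleanup : ∀ λ' z → 0ℚ + (λ' - 0ℚ) * z ≡ λ' * z
  cleanup = solve-∀ ℚ-ring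

mulVec-cong : ∀ {m} (A : Fin m → Fin m → ℚ) {x y : Fin m → ℚ} → (∀ u → x u ≡ y u) →
  ∀ t → mulVec A x t ≡ mulVec A y t
mulVec-cong A x≗y t = sumℚ-cong (λ u → cong (A t u *_) (x≗y u))

zero-or-eigenvector : ∀ {m} (G : Graph m) λ' x → (∀ t → mulVec (adjMat G) x t ≡ λ' * x t) →
  IsZeroVec x ⊎ IsEigenvector G λ' x
zero-or-eigenvector G λ' x Ax≡λx with all? (λ t → x t ≟ℚ 0ℚ)
... | yes x≡0 = inj₁ x≡0
... | no  x≢0 = inj₂ (x≢0 , Ax≡λx)

adjMat-rowSum : ∀ {m} (G : Graph m) t → sumℚ (adjMat G t) ≡ ι (deg G t)
adjMat-rowSum G t =
  ≡-sym (trans (ι-sumℕ (λ u → if adj G t u then 1 else 0)) (sumℚ-cong entry))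
  where
  entry : ∀ u → ι (if adj G t u then 1 else 0) ≡ adjMat G t u
  entry u with adj G t u
  ... | true  = refl
  ... | false = refl

adjMat-blockSum : ∀ {m n} (G : Graph m) (part : Fin m → Fin n) t l →
  sumℚ (λ u → adjMat G t u * δ (part u) l) ≡ ι (nbrsIn G part t l)
adjMat-blockSum G part t l =
  ≡-sym (trans (ι-sumℕ (λ u → if adj G t u then (if ⌊ part u ≟ l ⌋ then 1 else 0) else 0))
               (sumℚ-cong entry))
  where
  entry : ∀ u → ι (if adj G t u then (if ⌊ part u ≟ l ⌋ then 1 else 0) else 0)
              ≡ adjMat G t u * δ (part u) l
  entry u with adj G t u | ⌊ part u ≟ l ⌋
  ... | true  | true  = refl
  ... | true  | false = refl
  ... | false | true  = refl
  ... | false | false = refl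

nbrsIn≤deg : ∀ {m n} (G : Graph m) (part : Fin m → Fin n) v j → nbrsIn G part v j ℕ.≤ deg G v
nbrsIn≤deg G part v j = sumℕ-mono-≤ entry
  where
  entry : ∀ u → (if adj G v u then (if ⌊ part u ≟ j ⌋ then 1 else 0) else 0)
                ℕ.≤ (if adj G v u then 1 else 0)
  entry u with adj G v u | ⌊ part u ≟ j ⌋
  ... | true  | true  = ℕ.≤-refl
  ... | true  | false = ℕ.z≤n
  ... | false | _     = ℕ.z≤n

mulVec-adjMat-∘ : ∀ {m n} (G : Graph m) (part : Fin m → Fin n) (c : Fin n → Fin n → ℕ) →
  (∀ v j → nbrsIn G part v j ≡ c (part v) j) →
  ∀ (f : Fin n → ℚ) t → mulVec (adjMat G) (f ∘ part) t ≡ sumℚ (λ l → ι (c (part t) l) * f l)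
mulVec-adjMat-∘ G part c equitable f t = begin
  sumℚ (λ u → adjMat G t u * f (part u))
    ≡⟨ sumℚ-cong (λ u → cong (adjMat G t u *_) (≡-sym (sumℚ-δˡ (part u) f))) ⟩
  sumℚ (λ u → adjMat G t u * sumℚ (λ l → δ (part u) l * f l))
    ≡⟨ sumℚ-cong (λ u → ≡-sym (sumℚ-*ˡ (adjMat G t u) (λ l → δ (part u) l * f l))) ⟩
  sumℚ (λ u → sumℚ (λ l → adjMat G t u * (δ (part u) l * f l)))
    ≡⟨ sumℚ-swap (λ u l → adjMat G t u * (δ (part u) l * f l)) ⟩
  sumℚ (λ l → sumℚ (λ u → adjMat G t u * (δ (part u) l * f l)))
    ≡⟨ sumℚ-cong (λ l → trans (sumℚ-cong (λ u → reassoc (adjMat G t u) (δ (part u) l) (f l)))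
                              (sumℚ-*ˡ (f l) (λ u → adjMat G t u * δ (part u) l))) ⟩
  sumℚ (λ l → f l * sumℚ (λ u → adjMat G t u * δ (part u) l))
    ≡⟨ sumℚ-cong (λ l → trans (cong (f l *_) (trans (adjMat-blockSum G part t l)
                                                     (cong ι (equitable t l))))
                              (*-comm (f l) _)) ⟩
  sumℚ (λ l → ι (c (part t) l) * f l) ∎
  where
  open ≡-Reasoning
  reassoc : ∀ a b x → a * (b * x) ≡ x * (a * b)
  reassoc = solve-∀ ℚ-ring

quotient-rowSum : ∀ {m n k} (G : Graph m) → Regular G k →
  (part : Fin m → Fin n) (c : Fin n → Fin n → ℕ) → IsEquitable G part c →
  ∀ l → sumℚ (λ s → ι (c l s)) ≡ ι k
quotient-rowSum {k = k} G regular part c (surjective , equitable) l with surjective l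
... | v , refl = begin
  sumℚ (λ s → ι (c (part v) s))       ≡⟨ sumℚ-cong (λ s → ≡-sym (*-identityʳ (ι (c (part v) s)))) ⟩
  sumℚ (λ s → ι (c (part v) s) * 1ℚ)  ≡⟨ mulVec-adjMat-∘ G part c equitable (λ _ → 1ℚ) v ⟨
  sumℚ (λ u → adjMat G v u * 1ℚ)      ≡⟨ sumℚ-cong (λ u → *-identityʳ (adjMat G v u)) ⟩
  sumℚ (adjMat G v)                   ≡⟨ adjMat-rowSum G v ⟩
  ι (deg G v)                         ≡⟨ cong ι (regular v) ⟩
  ι k                                 ∎
  where open ≡-Reasoning

quotient≤degree : ∀ {m n k} (G : Graph m) → Regular G k →
  (part : Fin m → Fin n) (c : Fin n → Fin n → ℕ) → IsEquitable G part c →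
  ∀ l j → c l j ℕ.≤ k
quotient≤degree {k = k} G regular part c (surjective , equitable) l j with surjective l
... | v , refl = begin
  c (part v) j      ≡⟨ equitable v j ⟨
  nbrsIn G part v j ≤⟨ nbrsIn≤deg G part v j ⟩
  deg G v           ≡⟨ regular v ⟩
  k                 ∎
  where open ℕ.≤-Reasoning

rij-equation : ∀ {n} k (c : Fin n → Fin n → ℕ) (i j : Fin n) → c j j ℕ.≤ k →
  rij k c i j * (ι k + (ι (c i j) - ι (c j j))) ≡ ι (c i j)
rij-equation k c i j cjj≤k = begin
  rij k c i j * (ι k + (ι (c i j) - ι (c j j)))  ≡⟨ cong (rij k c i j *_) ι-denominator ⟨
  rij k c i j * ι (k ℕ.+ c i j ℕ.∸ c j j)        ≡⟨ divℕ-*-cancel (c i j) _ cij≤denominator ⟩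
  ι (c i j)                                       ∎
  where
  open ≡-Reasoning
  cjj≤k+cij : c j j ℕ.≤ k ℕ.+ c i j
  cjj≤k+cij = ℕ.≤-trans cjj≤k (ℕ.m≤m+n k (c i j))
  cij≤denominator : c i j ℕ.≤ k ℕ.+ c i j ℕ.∸ c j j
  cij≤denominator = ℕ.≤-trans (ℕ.m≤n+m (c i j) (k ℕ.∸ c j j))
                              (ℕ.≤-reflexive (≡-sym (ℕ.+-∸-comm (c i j) cjj≤k)))
  reassoc : ∀ x y z → (x + y) - z ≡ x + (y - z)
  reassoc = solve-∀ ℚ-ring
  ι-denominator : ι (k ℕ.+ c i j ℕ.∸ c j j) ≡ ι k + (ι (c i j) - ι (c j j))
  ι-denominator = trans (ι-∸ (k ℕ.+ c i j) (c j j) cjj≤k+cij)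
                        (trans (cong (_- ι (c j j)) (ι-+ k (c i j)))
                               (reassoc (ι k) (ι (c i j)) (ι (c j j))))

hBlock : ∀ {n} → ℚ → Fin n → (Fin n → ℚ) → Fin n → ℚ
hBlock r j d l = - r - (d l - δ l j)

hvec-blocks : ∀ {m n} k (part : Fin m → Fin n) c (i j : Fin n) d t →
  hvec k part c i j d t ≡ hBlock (rij k c i j) j d (part t)
hvec-blocks k part c i j d t =
  cong (λ z → - rij k c i j - z) (sumℚ-select (part t) (λ l → d l - δ l j))

quotient-hBlock : ∀ {n} k (c : Fin n → Fin n → ℕ) (j : Fin n) r d →
  (∀ l → sumℚ (λ s → ι (c l s)) ≡ ι k) →
  ∀ l → sumℚ (λ s → ι (c l s) * hBlock r j d s)
        ≡ (- r) * ι k + (- 1ℚ) * sumℚ (λ s → ι (c l s) * d s) + ι (c l j)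
quotient-hBlock k c j r d rowSum l = begin
  sumℚ (λ s → C s * hBlock r j d s)
    ≡⟨ sumℚ-cong (λ s → expand (C s) r (d s) (δ s j)) ⟩
  sumℚ (λ s → ((- r) * C s + (- 1ℚ) * (C s * d s)) + C s * δ s j)
    ≡⟨ sumℚ-+ (λ s → (- r) * C s + (- 1ℚ) * (C s * d s)) (λ s → C s * δ s j) ⟩
  sumℚ (λ s → (- r) * C s + (- 1ℚ) * (C s * d s)) + sumℚ (λ s → C s * δ s j)
    ≡⟨ cong₂ _+_ (sumℚ-+ (λ s → (- r) * C s) (λ s → (- 1ℚ) * (C s * d s))) (sumℚ-δʳ j C) ⟩
  (sumℚ (λ s → (- r) * C s) + sumℚ (λ s → (- 1ℚ) * (C s * d s))) + C j
    ≡⟨ cong (λ z → z + C j) (cong₂ _+_ (trans (sumℚ-*ˡ (- r) C) (cong ((- r) *_) (rowSum l)))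
                                        (sumℚ-*ˡ (- 1ℚ) (λ s → C s * d s))) ⟩
  (- r) * ι k + (- 1ℚ) * sumℚ (λ s → C s * d s) + C j ∎
  where
  open ≡-Reasoning
  C : _ → ℚ
  C s = ι (c l s)
  expand : ∀ x r y z → x * (- r - (y - z)) ≡ ((- r) * x + (- 1ℚ) * (x * y)) + x * z
  expand = solve-∀ ℚ-ring

quotient-shift-hBlock : ∀ {n} k (c : Fin n → Fin n → ℕ) (i j : Fin n) d →
  c j j ℕ.≤ k → (∀ l → sumℚ (λ s → ι (c l s)) ≡ ι k) → SolvesSystem c i j d →
  ∀ l → let a = ι (c i j) - ι (c j j); f = hBlock (rij k c i j) j d in
        sumℚ (λ s → ι (c l s) * f s) + a * f l ≡ 0ℚ
quotient-shift-hBlock k c i j d cjj≤k rowSum system l = begin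
  sumℚ (λ s → ι (c l s) * hBlock r j d s) + a * hBlock r j d l
    ≡⟨ cong (_+ a * hBlock r j d l) (quotient-hBlock k c j r d rowSum l) ⟩
  (- r) * ι k + (- 1ℚ) * X + Clj + a * (- r - (d l - δ l j))
    ≡⟨ regroup r (ι k) X Clj Cij Cjj (d l) (δ l j) ⟩
  (- 1ℚ) * ((X + a * d l) - ((Clj - Cij) + δ l j * a)) + (Cij - r * (ι k + a))
    ≡⟨ cong₂ (λ u v → (- 1ℚ) * (u - ((Clj - Cij) + δ l j * a)) + (Cij - v))
             (system l) (rij-equation k c i j cjj≤k) ⟩
  (- 1ℚ) * (((Clj - Cij) + δ l j * a) - ((Clj - Cij) + δ l j * a)) + (Cij - Cij)
    ≡⟨ cancel ((Clj - Cij) + δ l j * a) Cij ⟩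
  0ℚ ∎
  where
  open ≡-Reasoning
  r = rij k c i j
  Cij = ι (c i j)
  Cjj = ι (c j j)
  Clj = ι (c l j)
  a = Cij - Cjj
  X = sumℚ (λ s → ι (c l s) * d s)
  regroup : ∀ r K X Clj Cij Cjj dl δlj →
    (- r) * K + (- 1ℚ) * X + Clj + (Cij - Cjj) * (- r - (dl - δlj))
    ≡ (- 1ℚ) * ((X + (Cij - Cjj) * dl) - ((Clj - Cij) + δlj * (Cij - Cjj)))
      + (Cij - r * (K + (Cij - Cjj)))
  regroup = solve-∀ ℚ-ring
  cancel : ∀ x y → (- 1ℚ) * (x - x) + (y - y) ≡ 0ℚ
  cancel = solve-∀ ℚ-ring

shiftMat-adjMat-∘ : ∀ {m n} (G : Graph m) (part : Fin m → Fin n) (c : Fin n → Fin n → ℕ) →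
  (∀ v j → nbrsIn G part v j ≡ c (part v) j) → ∀ a (f : Fin n → ℚ) →
  (∀ l → sumℚ (λ s → ι (c l s) * f s) + a * f l ≡ 0ℚ) →
  IsZeroVec (mulVec (shiftMat (adjMat G) a) (f ∘ part))
shiftMat-adjMat-∘ G part c equitable a f kernel t = begin
  mulVec (shiftMat (adjMat G) a) (f ∘ part) t
    ≡⟨ mulVec-shiftMat (adjMat G) a (f ∘ part) t ⟩
  mulVec (adjMat G) (f ∘ part) t + a * f (part t)
    ≡⟨ cong (_+ a * f (part t)) (mulVec-adjMat-∘ G part c equitable f t) ⟩
  sumℚ (λ s → ι (c (part t) s) * f s) + a * f (part t)
    ≡⟨ kernel (part t) ⟩
  0ℚ ∎
  where open ≡-Reasoning

corollary2p7 : (m n k : ℕ) (G : Graph m) → Regular G k → k ≥ 1 → Connected G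
    → (part : Fin m → Fin n) (c : Fin n → Fin n → ℕ) → IsEquitable G part c
    → (i j : Fin n) → i ≢ j
    → (d : Fin n → ℚ) → SolvesSystem c i j d
    → IsZeroVec (mulVec (shiftMat (adjMat G) (ι (c i j) - ι (c j j)))
                        (hvec k part c i j d))
      × (IsZeroVec (hvec k part c i j d)
         ⊎ IsEigenvector G (ι (c j j) - ι (c i j)) (hvec k part c i j d))
-- The identity holds without k ≥ 1, connectedness or i ≢ j.
corollary2p7 m n k G regular _ _ part c equitable@(_ , nbrs≡c) i j _ d system =
  kernel ,
  zero-or-eigenvector G λ' h (shiftMat-kernel⇒eigen (adjMat G) a λ' h (opposite Cjj Cij) kernel)
  where
  Cij = ι (c i j)
  Cjj = ι (c j j)
  a = Cij - Cjj
  λ' = Cjj - Cij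
  h = hvec k part c i j d
  opposite : ∀ x y → (x - y) + (y - x) ≡ 0ℚ
  opposite = solve-∀ ℚ-ring
  kernel : IsZeroVec (mulVec (shiftMat (adjMat G) a) h)
  kernel t = trans (mulVec-cong (shiftMat (adjMat G) a) (hvec-blocks k part c i j d) t)
    (shiftMat-adjMat-∘ G part c nbrs≡c a (hBlock (rij k c i j) j d)
      (quotient-shift-hBlock k c i j d (quotient≤degree G regular part c equitable j j)
        (quotient-rowSum G regular part c equitable) system) t)
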